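{- Let $G=(V,E)$ be a simple graph, let $(F,M)$ be a valid partition of $G$ with $k$ colors, and let $H=(V,M)$ be its surplus graph. Let $C=(V_C,E_C)$ be a connected component of $H$ which is colorful and contains a cycle. Then for every $v\in V_C$ there is a color $i$ such that some edge of $E_C$ has color $i$ and $v$ has no neighbor in $V_C$ with respect to the forest $F_i$.
   Context: A pseudoforest is a graph in which each connected component contains at most one cycle. For a pseudoforest $(V,P)$, a $P$-matching is a set obtained by choosing exactly one edge on each cycle of $(V,P)$. A valid partition of $G=(V,E)$ with $k$ colors is a partition $E=F\,\dot\cup\, M$ with $F=F_1\dot\cup\cdots\dot\cup F_k$ and $M=M_1\dot\cup\cdots\dot\cup M_k$ such that each $F_i$ is a forest, $P_i=F_i\cup M_i$ is a pseudoforest, and $M_i$ is a $P_i$-matching. Edges of $F_i$ and $M_i$ have color $i$. The surplus graph is $H=(V,M)$. A connected component of $H$ is colorful if every color appears on at most one of its edges. -}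

module Defs where

open import Data.Nat using (ℕ; zero; suc; _≤_; _<_; s≤s)
open import Data.Nat.Properties using (_<?_)
open import Data.Fin using (Fin; zero; suc; toℕ; fromℕ<)
open import Data.Bool using (Bool; true; false)
open import Data.Product using (Σ; _×_; _,_; proj₁; proj₂; ∃-syntax)
open import Data.Sum using (_⊎_)
open import Relation.Nullary using (¬_; yes; no)
open import Relation.Binary.PropositionalEquality using (_≡_; _≢_)
open import Function using (_⇔_)
open import Function.Definitions using (Injective)

next : ∀ {l} → Fin (suc l) → Fin (suc l)
next {l} i with toℕ i <? l
... | yes p = fromℕ< (s≤s p)
... | no _  = zero

record Graph (n m : ℕ) : Set where
  field
    ends : Fin m → Fin n × Fin n

  Joins : Fin m → Fin n → Fin n → Set
  Joins e a b = (ends e ≡ (a , b)) ⊎ (ends e ≡ (b , a))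

  field
    noLoop     : ∀ e → proj₁ (ends e) ≢ proj₂ (ends e)
    noParallel : ∀ e e' a b → Joins e a b → Joins e' a b → e ≡ e'

EdgeSet : ℕ → Set₁
EdgeSet m = Fin m → Set

module _ {n m : ℕ} (G : Graph n m) where
  open Graph G

  data Reach (S : EdgeSet m) : Fin n → Fin n → Set where
    here : ∀ {u} → Reach S u u
    step : ∀ {u w v} e → S e → Joins e u w → Reach S w v → Reach S u v

  record Cycle (S : EdgeSet m) : Set where
    field
      len      : ℕ
      len≥3    : 3 ≤ suc len
      vs       : Fin (suc len) → Fin n
      vs-inj   : Injective _≡_ _≡_ vs
      es       : Fin (suc len) → Fin m
      es-in    : ∀ j → S (es j)
      es-joins : ∀ j → Joins (es j) (vs j) (vs (next j))

  OnCycle : ∀ {S} → Cycle S → Fin m → Set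
  OnCycle c e = ∃[ j ] Cycle.es c j ≡ e

  Forest : EdgeSet m → Set
  Forest S = ¬ Cycle S

  -- a pseudoforest: each connected component contains at most one cycle,
  -- i.e. any two cycles lying in the same component are the same (edge set).
  Pseudoforest : EdgeSet m → Set
  Pseudoforest P = ∀ (c c' : Cycle P) →
    Reach P (Cycle.vs c zero) (Cycle.vs c' zero) →
    ∀ e → (OnCycle c e ⇔ OnCycle c' e)

  -- a P-matching: obtained by choosing exactly one edge on each cycle of (V,P)
  PMatching : EdgeSet m → EdgeSet m → Set
  PMatching P Mi =
    (∀ e → Mi e → Σ (Cycle P) λ c → OnCycle c e) ×
    (∀ (c : Cycle P) → ∃[ j ] (Mi (Cycle.es c j) ×
        (∀ j' → Mi (Cycle.es c j') → Cycle.es c j' ≡ Cycle.es c j)))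

  -- A valid partition with k colors: every edge gets a color col e and is
  -- either in F (inM e ≡ false) or in M (inM e ≡ true).
  record ValidPartition (k : ℕ) : Set₁ where
    field
      col : Fin m → Fin k
      inM : Fin m → Bool

    F : Fin k → EdgeSet m
    F i e = (col e ≡ i) × (inM e ≡ false)

    Mc : Fin k → EdgeSet m
    Mc i e = (col e ≡ i) × (inM e ≡ true)

    P : Fin k → EdgeSet m
    P i e = col e ≡ i

    M : EdgeSet m
    M e = inM e ≡ true

    field
      forest   : ∀ i → Forest (F i)
      pseudo   : ∀ i → Pseudoforest (P i)
      matching : ∀ i → PMatching (P i) (Mc i)

    -- the connected component of H containing r
    VC : Fin n → Fin n → Set
    VC r v = Reach M r v

    EC : Fin n → EdgeSet m
    EC r e = M e × VC r (proj₁ (ends e)) × VC r (proj₂ (ends e))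

    Colorful : Fin n → Set
    Colorful r = ∀ e e' → EC r e → EC r e' → col e ≡ col e' → e ≡ e'

    ComponentHasCycle : Fin n → Set
    ComponentHasCycle r = Σ (Cycle M) λ c → ∀ j → VC r (Cycle.vs c j)

{-# OPTIONS --safe #-}
-- Colourfulness makes col injective on E_C. Let each cycle vertex of C own the cycle edge to its
-- successor, and every other vertex of C an edge into the previous layer of a breadth-first search
-- from the cycle; distinct vertices own distinct edges, so V_C injects into the colours used on
-- E_C. If every such colour i gave v an F_i-neighbour in V_C, the map sending w to the
-- F_(colour of w)-neighbour of v would be an injective self-map of the finite set V_C (G is
-- simple) that misses v (G has no loops).
module Submission where

open import Defs
open import Data.Nat using (ℕ; zero; suc; _+_; _∸_; _≤_; _<_; z≤n; s≤s; z<s)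
open import Data.Nat.Properties
  using ( _<?_; ≤-refl; ≤-reflexive; ≤-trans; ≤-total; ≤-antisym; ≤-pred; n≤1+n; n<1+n
        ; ≮⇒≥; <⇒≢; <⇒≱; m<n+m; +-suc; m∸n+n≡m; m≤n⇒∃[o]m+o≡n )
open import Data.Nat.GeneralisedArithmetic using (fold; fold-+)
open import Data.Bool using (true; false)
import Data.Bool.Properties as Bool
open import Data.Fin using (Fin; zero; toℕ)
open import Data.Fin.Properties using (_≟_; any?; pigeonhole; toℕ-fromℕ<; toℕ<n)
open import Data.Fin.Subset using (Subset; inside; outside; _∈_; _∉_; _⊆_; _⊂_; ∣_∣; ⁅_⁆)
open import Data.Fin.Subset.Properties
  using (_∈?_; ⊆-trans; drop-∷-⊆; s⊂s; out⊂in; ∣p∣≤n; p⊂q⇒∣p∣<∣q∣; x∈⁅x⁆; x∈⁅y⁆⇒x≡y)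
open import Data.Vec using ([]; _∷_; here; tabulate)
open import Data.Vec.Properties using ([]=⇒lookup; lookup⇒[]=; lookup∘tabulate)
open import Data.Product using (Σ; _×_; _,_; proj₁; proj₂; ∃-syntax)
open import Data.Product.Properties using (≡-dec)
open import Data.Sum using (_⊎_; inj₁; inj₂)
import Data.Sum as Sum
open import Function using (_∘_; id)
open import Relation.Nullary using (¬_; Dec; does; yes; no; contradiction)
open import Relation.Nullary.Decidable using (_×-dec_; _⊎-dec_; ¬?; map′; dec-true)
open import Relation.Unary using (Pred; Decidable)
open import Relation.Binary.PropositionalEquality
  using (_≡_; _≢_; refl; sym; trans; cong; subst; module ≡-Reasoning)

open ≡-Reasoning

select : ∀ {n ℓ} {P : Pred (Fin n) ℓ} → Decidable P → Subset n
select P? = tabulate (λ x → does (P? x))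

module _ {n ℓ} {P : Pred (Fin n) ℓ} (P? : Decidable P) {x : Fin n} where

  ∈-select⁺ : P x → x ∈ select P?
  ∈-select⁺ px = lookup⇒[]= x _ (trans (lookup∘tabulate _ x) (dec-true (P? x) px))

  ∈-select⁻ : x ∈ select P? → P x
  ∈-select⁻ x∈ with trans (sym (lookup∘tabulate _ x)) ([]=⇒lookup x∈)
  ... | chosen with P? x
  ...   | yes px = px
  ...   | no _   = contradiction chosen λ ()

⊆⇒≡⊎⊂ : ∀ {n} {p q : Subset n} → p ⊆ q → p ≡ q ⊎ p ⊂ q
⊆⇒≡⊎⊂ {p = []}          {[]}          _   = inj₁ refl
⊆⇒≡⊎⊂ {p = inside ∷ p}  {outside ∷ q} p⊆q = contradiction (p⊆q here) λ ()
⊆⇒≡⊎⊂ {p = outside ∷ p} {inside ∷ q}  p⊆q = inj₂ (out⊂in (drop-∷-⊆ p⊆q))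
⊆⇒≡⊎⊂ {p = inside ∷ p}  {inside ∷ q}  p⊆q = Sum.map (cong (inside ∷_)) s⊂s (⊆⇒≡⊎⊂ (drop-∷-⊆ p⊆q))
⊆⇒≡⊎⊂ {p = outside ∷ p} {outside ∷ q} p⊆q = Sum.map (cong (outside ∷_)) s⊂s (⊆⇒≡⊎⊂ (drop-∷-⊆ p⊆q))

module _ {n} (step : Subset n → Subset n) (inflationary : ∀ p → p ⊆ step p) where

  fold-⊆-+ : ∀ p t d → fold p step t ⊆ fold p step (d + t)
  fold-⊆-+ p t zero    = id
  fold-⊆-+ p t (suc d) = ⊆-trans (fold-⊆-+ p t d) (inflationary _)

  fold-mono : ∀ p {t t'} → t ≤ t' → fold p step t ⊆ fold p step t'
  fold-mono p {t} {t'} t≤t' =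
    subst (λ s → fold p step t ⊆ fold p step s) (m∸n+n≡m t≤t') (fold-⊆-+ p t (t' ∸ t))

  fixed-or-grows : ∀ p → step p ≡ p ⊎ ∣ p ∣ < ∣ step p ∣
  fixed-or-grows p = Sum.map sym p⊂q⇒∣p∣<∣q∣ (⊆⇒≡⊎⊂ (inflationary p))

  fixed-or-large : ∀ p t →
    (∃[ s ] s ≤ t × step (fold p step s) ≡ fold p step s) ⊎ t < ∣ fold p step (suc t) ∣
  fixed-or-large p zero with fixed-or-grows p
  ... | inj₁ fixed = inj₁ (zero , z≤n , fixed)
  ... | inj₂ grows = inj₂ (≤-trans (s≤s z≤n) grows)
  fixed-or-large p (suc t) with fixed-or-large p t
  ... | inj₁ (s , s≤t , fixed) = inj₁ (s , ≤-trans s≤t (n≤1+n t) , fixed)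
  ... | inj₂ large with fixed-or-grows (fold p step (suc t))
  ...   | inj₁ fixed = inj₁ (suc t , ≤-refl , fixed)
  ...   | inj₂ grows = inj₂ (≤-trans (s≤s large) grows)

  fixed-within-n : ∀ p → ∃[ s ] s ≤ n × step (fold p step s) ≡ fold p step s
  fixed-within-n p with fixed-or-large p n
  ... | inj₁ fixed = fixed
  ... | inj₂ large = contradiction (∣p∣≤n (fold p step (suc n))) (<⇒≱ large)

  fold-fixed : ∀ {q} → step q ≡ q → ∀ d → fold q step d ≡ q
  fold-fixed fixed zero    = refl
  fold-fixed fixed (suc d) = trans (cong step (fold-fixed fixed d)) fixed

  fold-⊆-fold-n : ∀ p t → fold p step t ⊆ fold p step n
  fold-⊆-fold-n p t with fixed-within-n p
  ... | s , s≤n , fixed with ≤-total t s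
  ...   | inj₁ t≤s = fold-mono p (≤-trans t≤s s≤n)
  ...   | inj₂ s≤t = subst (λ q → q ⊆ fold p step n) eq (fold-mono p s≤n)
    where
      eq : fold p step s ≡ fold p step t
      eq = trans (sym (fold-fixed fixed (t ∸ s)))
                 (trans (sym (fold-+ p step (t ∸ s))) (cong (fold p step) (m∸n+n≡m s≤t)))

module _ {a k} {X : Set a} (ι : X → Fin k) (f : X → X)
         (f-injective : ∀ {x y} → ι (f x) ≡ ι (f y) → ι x ≡ ι y) where

  fold-injective : ∀ t {x y} → ι (fold x f t) ≡ ι (fold y f t) → ι x ≡ ι y
  fold-injective zero    eq = eq
  fold-injective (suc t) eq = fold-injective t (f-injective eq)

  injective-self-map-surjective : ∀ x₀ → ∃[ x ] ι (f x) ≡ ι x₀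
  injective-self-map-surjective x₀
    with i , j , i<j , same ← pigeonhole (n<1+n k) (λ t → ι (fold x₀ f (toℕ t)))
    with d , i+1+d≡j ← m≤n⇒∃[o]m+o≡n i<j
    = fold x₀ f d , sym (fold-injective (toℕ i) (trans same (cong ι orbit-j)))
    where
      orbit-j : fold x₀ f (toℕ j) ≡ fold (f (fold x₀ f d)) f (toℕ i)
      orbit-j = trans (cong (fold x₀ f) (trans (sym i+1+d≡j) (sym (+-suc (toℕ i) d))))
                      (fold-+ x₀ f (toℕ i))

toℕ-next : ∀ {l} (j : Fin (suc l)) →
  toℕ (next j) ≡ suc (toℕ j) ⊎ (toℕ j ≡ l × next j ≡ zero)
toℕ-next {l} j with toℕ j <? l
... | yes j<l = inj₁ (toℕ-fromℕ< (s≤s j<l))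
... | no  j≮l = inj₂ (≤-antisym (≤-pred (toℕ<n j)) (≮⇒≥ j≮l) , refl)

next∘next≢id : ∀ {l} → 2 ≤ l → (j : Fin (suc l)) → next (next j) ≢ j
next∘next≢id {l} 2≤l j eq with toℕ-next j | toℕ-next (next j)
... | inj₁ p | inj₁ q = <⇒≢ (m<n+m (toℕ j) z<s) (sym (begin
  2 + toℕ j              ≡⟨ cong suc (sym p) ⟩
  suc (toℕ (next j))     ≡⟨ sym q ⟩
  toℕ (next (next j))    ≡⟨ cong toℕ eq ⟩
  toℕ j                  ∎))
... | inj₁ p | inj₂ (q , z) = <⇒≱ 2≤l (≤-reflexive (begin
  l                      ≡⟨ sym q ⟩
  toℕ (next j)           ≡⟨ p ⟩
  suc (toℕ j)            ≡⟨ cong (suc ∘ toℕ) (trans (sym eq) z) ⟩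
  1                      ∎))
... | inj₂ (p , z) | inj₁ q = <⇒≱ 2≤l (≤-reflexive (begin
  l                      ≡⟨ sym p ⟩
  toℕ j                  ≡⟨ cong toℕ (sym eq) ⟩
  toℕ (next (next j))    ≡⟨ q ⟩
  suc (toℕ (next j))     ≡⟨ cong (suc ∘ toℕ) z ⟩
  1                      ∎))
... | inj₂ (p , z) | inj₂ (q , _) = <⇒≱ 2≤l (≤-trans (≤-reflexive (begin
  l                      ≡⟨ sym q ⟩
  toℕ (next j)           ≡⟨ cong toℕ z ⟩
  0                      ∎)) z≤n)

module _ {n m} (G : Graph n m) where
  open Graph G

  Joins-sym : ∀ {e a b} → Joins e a b → Joins e b a
  Joins-sym (inj₁ ends≡ab) = inj₂ ends≡ab
  Joins-sym (inj₂ ends≡ba) = inj₁ ends≡ba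

  Joins-ends : ∀ {e a b c d} → Joins e a b → Joins e c d →
    (a ≡ c × b ≡ d) ⊎ (a ≡ d × b ≡ c)
  Joins-ends (inj₁ p) (inj₁ q) = inj₁ (cong proj₁ (trans (sym p) q) , cong proj₂ (trans (sym p) q))
  Joins-ends (inj₁ p) (inj₂ q) = inj₂ (cong proj₁ (trans (sym p) q) , cong proj₂ (trans (sym p) q))
  Joins-ends (inj₂ p) (inj₁ q) = inj₂ (cong proj₂ (trans (sym p) q) , cong proj₁ (trans (sym p) q))
  Joins-ends (inj₂ p) (inj₂ q) = inj₁ (cong proj₂ (trans (sym p) q) , cong proj₁ (trans (sym p) q))

  Joins-endpoint : ∀ {e a b c d} → Joins e a b → Joins e c d → c ≡ a ⊎ c ≡ b
  Joins-endpoint J J' with Joins-ends J J'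
  ... | inj₁ (a≡c , _) = inj₁ (sym a≡c)
  ... | inj₂ (_ , b≡c) = inj₂ (sym b≡c)

  Joins-irrefl : ∀ {e a} → ¬ Joins e a a
  Joins-irrefl {e} (inj₁ q) = noLoop e (trans (cong proj₁ q) (sym (cong proj₂ q)))
  Joins-irrefl {e} (inj₂ q) = noLoop e (trans (cong proj₁ q) (sym (cong proj₂ q)))

  Joins? : ∀ e a b → Dec (Joins e a b)
  Joins? e a b = ≡-dec _≟_ _≟_ (ends e) (a , b) ⊎-dec ≡-dec _≟_ _≟_ (ends e) (b , a)

  Reach-++ : ∀ {S a b c} → Reach G S a b → Reach G S b c → Reach G S a c
  Reach-++ here            q = q
  Reach-++ (step e s J p) q = step e s J (Reach-++ p q)

  Reach-sym : ∀ {S a b} → Reach G S a b → Reach G S b a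
  Reach-sym here           = here
  Reach-sym (step e s J p) = Reach-++ (Reach-sym p) (step e s (Joins-sym J) here)

  module Layers {S : EdgeSet m} (S? : ∀ e → Dec (S e)) where

    Adjacent : Subset n → Fin n → Set
    Adjacent p w = ∃[ e ] S e × ∃[ u ] Joins e w u × u ∈ p

    Adjacent? : ∀ p w → Dec (Adjacent p w)
    Adjacent? p w = any? λ e → S? e ×-dec any? λ u → Joins? e w u ×-dec u ∈? p

    WithinOneStep : Subset n → Fin n → Set
    WithinOneStep p w = w ∈ p ⊎ Adjacent p w

    WithinOneStep? : ∀ p w → Dec (WithinOneStep p w)
    WithinOneStep? p w = w ∈? p ⊎-dec Adjacent? p w

    grow : Subset n → Subset n
    grow p = select (WithinOneStep? p)

    ∈-grow⁺ : ∀ {p w} → WithinOneStep p w → w ∈ grow p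
    ∈-grow⁺ {p} = ∈-select⁺ (WithinOneStep? p)

    ∈-grow⁻ : ∀ {p w} → w ∈ grow p → WithinOneStep p w
    ∈-grow⁻ {p} = ∈-select⁻ (WithinOneStep? p)

    grow-inflationary : ∀ p → p ⊆ grow p
    grow-inflationary p w∈p = ∈-grow⁺ (inj₁ w∈p)

    layer : Subset n → ℕ → Subset n
    layer X = fold X grow

    layer-mono : ∀ X {t t'} → t ≤ t' → layer X t ⊆ layer X t'
    layer-mono X = fold-mono grow grow-inflationary X

    layer-sound : ∀ {X w} t → w ∈ layer X t → ∃[ x ] x ∈ X × Reach G S x w
    layer-sound zero    w∈X = _ , w∈X , here
    layer-sound (suc t) w∈  with ∈-grow⁻ w∈
    ... | inj₁ w∈layer = layer-sound t w∈layer
    ... | inj₂ (e , s , u , J , u∈layer) with layer-sound t u∈layer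
    ...   | x , x∈X , x↝u = x , x∈X , Reach-++ x↝u (step e s (Joins-sym J) here)

    layer-reached : ∀ {X x w} → x ∈ X → Reach G S x w → ∃[ t ] w ∈ layer X t
    layer-reached = go 0
      where
        go : ∀ {X x w} t → x ∈ layer X t → Reach G S x w → ∃[ t ] w ∈ layer X t
        go t x∈ here             = t , x∈
        go t x∈ (step e s J x↝w) = go (suc t) (∈-grow⁺ (inj₂ (e , s , _ , Joins-sym J , x∈))) x↝w

    layer-complete : ∀ {X x w} → x ∈ X → Reach G S x w → w ∈ layer X n
    layer-complete x∈X x↝w with layer-reached x∈X x↝w
    ... | t , w∈ = fold-⊆-fold-n grow grow-inflationary _ t w∈

    Reach? : ∀ a b → Dec (Reach G S a b)
    Reach? a b = map′ from-layer (layer-complete (x∈⁅x⁆ a)) (b ∈? layer ⁅ a ⁆ n)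
      where
        from-layer : b ∈ layer ⁅ a ⁆ n → Reach G S a b
        from-layer b∈ with layer-sound n b∈
        ... | x , x∈ , x↝b rewrite x∈⁅y⁆⇒x≡y a x∈ = x↝b

    layer-entry : ∀ {X w} t → w ∈ layer X t → w ∉ X →
      ∃[ s ] w ∉ layer X s × Adjacent (layer X s) w
    layer-entry          zero    w∈ w∉X = contradiction w∈ w∉X
    layer-entry {X} {w} (suc t) w∈ w∉X with w ∈? layer X t
    ... | yes w∈layer = layer-entry t w∈layer w∉X
    ... | no  w∉layer with ∈-grow⁻ w∈
    ...   | inj₁ w∈layer = contradiction w∈layer w∉layer
    ...   | inj₂ adjacent = t , w∉layer , adjacent

module ComponentWithCycle {n m} (G : Graph n m) {S : EdgeSet m} (S? : ∀ e → Dec (S e))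
  {r : Fin n} (c : Cycle G S) (cycle⊆C : ∀ j → Reach G S r (Cycle.vs c j)) where
  open Graph G
  open Cycle c
  open Layers G S?

  ComponentEdge : Fin m → Set
  ComponentEdge e = S e × Reach G S r (proj₁ (ends e)) × Reach G S r (proj₂ (ends e))

  component-edge : ∀ {e a b} → S e → Joins e a b → Reach G S r a → Reach G S r b → ComponentEdge e
  component-edge s (inj₁ ends≡ab) r↝a r↝b rewrite ends≡ab = s , r↝a , r↝b
  component-edge s (inj₂ ends≡ba) r↝a r↝b rewrite ends≡ba = s , r↝b , r↝a

  cycleVertex? : ∀ w → Dec (∃[ j ] vs j ≡ w)
  cycleVertex? w = any? λ j → vs j ≟ w

  cycleVertices : Subset n
  cycleVertices = select cycleVertex?

  on-cycle : ∀ j → vs j ∈ cycleVertices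
  on-cycle j = ∈-select⁺ cycleVertex? (j , refl)

  cycleVertices⊆layer : ∀ {w} t → w ∈ cycleVertices → w ∈ layer cycleVertices t
  cycleVertices⊆layer t = layer-mono cycleVertices (z≤n {t})

  layer⊆C : ∀ {w} t → w ∈ layer cycleVertices t → Reach G S r w
  layer⊆C t w∈ with layer-sound t w∈
  ... | x , x∈ , x↝w with ∈-select⁻ cycleVertex? x∈
  ...   | j , refl = Reach-++ G (cycle⊆C j) x↝w

  C⊆layer : ∀ {w} → Reach G S r w → w ∈ layer cycleVertices n
  C⊆layer r↝w = layer-complete (on-cycle zero) (Reach-++ G (Reach-sym G (cycle⊆C zero)) r↝w)

  -- An edge of the search tree has its two ends in different layers and no cycle vertex leaves
  -- the cycle, so every edge is the out-edge of at most one vertex.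
  data OutEdge : Fin n → Fin m → Set where
    along-cycle   : ∀ {e} j → Joins e (vs j) (vs (next j)) → OutEdge (vs j) e
    towards-cycle : ∀ {e w u} t → w ∉ layer cycleVertices t → Joins e w u →
                    u ∈ layer cycleVertices t → OutEdge w e

  outEdge : ∀ w → Reach G S r w → ∃[ e ] ComponentEdge e × OutEdge w e
  outEdge w r↝w with w ∈? cycleVertices
  ... | yes w∈ with ∈-select⁻ cycleVertex? w∈
  ...   | j , refl =
    es j , component-edge (es-in j) (es-joins j) (cycle⊆C j) (cycle⊆C (next j)) ,
    along-cycle j (es-joins j)
  outEdge w r↝w | no w∉ with layer-entry n (C⊆layer r↝w) w∉
  ... | t , w∉layer , e , s , u , J , u∈layer =
    e , component-edge s J r↝w (layer⊆C t u∈layer) , towards-cycle t w∉layer J u∈layer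

  OutEdge-injective : ∀ {w w' e} → OutEdge w e → OutEdge w' e → w ≡ w'
  OutEdge-injective (along-cycle j J) (along-cycle j' J') with Joins-ends G J J'
  ... | inj₁ (same , _) = same
  ... | inj₂ (crossed , crossed') =
    contradiction (trans (cong next (sym (vs-inj crossed))) (vs-inj crossed'))
                  (next∘next≢id (≤-pred len≥3) j')
  OutEdge-injective (along-cycle j J) (towards-cycle t w'∉ J' _) =
    contradiction (cycleVertices⊆layer t (endpoint-on-cycle (Joins-endpoint G J J'))) w'∉
    where
      endpoint-on-cycle : ∀ {x} → x ≡ vs j ⊎ x ≡ vs (next j) → x ∈ cycleVertices
      endpoint-on-cycle (inj₁ refl) = on-cycle j
      endpoint-on-cycle (inj₂ refl) = on-cycle (next j)
  OutEdge-injective out@(towards-cycle _ _ _ _) out'@(along-cycle _ _) =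
    sym (OutEdge-injective out' out)
  OutEdge-injective (towards-cycle t w∉ J u∈) (towards-cycle t' w'∉ J' u'∈)
    with Joins-ends G J J'
  ... | inj₁ (same , _) = same
  ... | inj₂ (w≡u' , u≡w') with ≤-total t t'
  ...   | inj₁ t≤t' =
    contradiction (subst (_∈ _) u≡w' (layer-mono cycleVertices t≤t' u∈)) w'∉
  ...   | inj₂ t'≤t =
    contradiction (subst (_∈ _) (sym w≡u') (layer-mono cycleVertices t'≤t u'∈)) w∉

module _ {n m k} {G : Graph n m} (Π : ValidPartition G k) where
  open Graph G
  open ValidPartition Π

  M? : ∀ e → Dec (M e)
  M? e = inM e Bool.≟ true

  open Layers G M? using (Reach?)

  Used : Fin n → Fin k → Set
  Used r i = ∃[ e ] EC r e × col e ≡ i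

  Covered : Fin n → Fin n → Fin k → Set
  Covered r v i = ∃[ e ] ∃[ w ] F i e × Joins e v w × VC r w

  Used? : ∀ r i → Dec (Used r i)
  Used? r i = any? λ e → (M? e ×-dec Reach? r _ ×-dec Reach? r _) ×-dec col e ≟ i

  Covered? : ∀ r v i → Dec (Covered r v i)
  Covered? r v i = any? λ e → any? λ w →
    ((col e ≟ i) ×-dec (inM e Bool.≟ false)) ×-dec Joins? G e v w ×-dec Reach? r w

  record ColourInjection (r : Fin n) : Set where
    field
      colour           : ∀ w → VC r w → Fin k
      colour-used      : ∀ w w∈ → Used r (colour w w∈)
      colour-injective : ∀ {w w' w∈ w'∈} → colour w w∈ ≡ colour w' w'∈ → w ≡ w'

  colourInjection : ∀ {r} → Colorful r → ComponentHasCycle r → ColourInjection r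
  colourInjection {r} colorful (c , c⊆C) = record
    { colour           = λ w w∈ → col (proj₁ (outEdge w w∈))
    ; colour-used      = λ w w∈ → proj₁ (outEdge w w∈) , proj₁ (proj₂ (outEdge w w∈)) , refl
    ; colour-injective = injective
    }
    where
      open ComponentWithCycle G M? c c⊆C
      injective : ∀ {w w' w∈ w'∈} →
        col (proj₁ (outEdge w w∈)) ≡ col (proj₁ (outEdge w' w'∈)) → w ≡ w'
      injective {w} {w'} {w∈} {w'∈} same-colour with outEdge w w∈ | outEdge w' w'∈
      ... | e , e∈ , out | e' , e'∈ , out' =
        OutEdge-injective out (subst (OutEdge w') (sym (colorful e e' e∈ e'∈ same-colour)) out')

  uncovered-colour : ∀ {r} → ColourInjection r → ∀ v → VC r v → ∃[ i ] Used r i × ¬ Covered r v i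
  uncovered-colour {r} ι v v∈C with any? (λ i → Used? r i ×-dec ¬? (Covered? r v i))
  ... | yes found = found
  ... | no  none  =
    contradiction (injective-self-map-surjective colourOf neighbour neighbour-injective (v , v∈C))
                  never-v
    where
      open ColourInjection ι

      X : Set
      X = Σ (Fin n) (VC r)

      colourOf : X → Fin k
      colourOf (w , w∈) = colour w w∈

      covered : ∀ x → Covered r v (colourOf x)
      covered (w , w∈) with Covered? r v (colour w w∈)
      ... | yes c = c
      ... | no ¬c = contradiction (colour w w∈ , colour-used w w∈ , ¬c) none

      endpoint : ∀ {i} → Covered r v i → X
      endpoint (_ , w , _ , _ , w∈) = w , w∈

      neighbour : X → X
      neighbour x = endpoint (covered x)

      neighbour-injective : ∀ {x y} →
        colourOf (neighbour x) ≡ colourOf (neighbour y) → colourOf x ≡ colourOf y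
      neighbour-injective {x} {y} eq with covered x | covered y
      ... | e , w , (col-e , _) , J , _ | e' , w' , (col-e' , _) , J' , _ with colour-injective eq
      ...   | refl = trans (sym col-e) (trans (cong col (noParallel e e' v w J J')) col-e')

      never-v : ¬ (∃[ x ] colourOf (neighbour x) ≡ colourOf (v , v∈C))
      never-v (x , eq) with covered x
      ... | e , w , _ , J , _ with colour-injective eq
      ...   | refl = Joins-irrefl G J

lemma10 : ∀ {n m k : ℕ} (G : Graph n m) (Π : ValidPartition G k) (r : Fin n) →
    ValidPartition.Colorful Π r →
    ValidPartition.ComponentHasCycle Π r →
    ∀ v → ValidPartition.VC Π r v →
    ∃[ i ] ((∃[ e ] (ValidPartition.EC Π r e × ValidPartition.col Π e ≡ i)) ×
      ¬ (∃[ e ] ∃[ w ] (ValidPartition.F Π i e × Graph.Joins G e v w × ValidPartition.VC Π r w)))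
lemma10 G Π r colorful hasCycle v v∈C =
  uncovered-colour Π (colourInjection Π colorful hasCycle) v v∈C
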